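{- Let $\mathbf{U}=(\mathbf{T},\exists)$ be a monadic $N_c$-algebra with center $c$, let $\forall x:=\sim\exists(\sim x)$, and let $C(T)=\{x\in T:x\geq c\}$. Then $C(T)$ is closed under $\exists$ and $\forall$, and $C(\mathbf{U})=(\langle C(T),\wedge,\vee,\to,c,1\rangle,\forall,\exists)$ (all operations restricted from $T$) is a monadic Gödel algebra. Moreover, if $f:(\mathbf{T},\exists)\to(\mathbf{S},\exists)$ is a homomorphism of monadic $N_c$-algebras, then $C(f):C(T)\to C(S)$, $C(f)(x)=f(x)$, is a homomorphism of monadic Gödel algebras.
   Context: A De Morgan algebra is a bounded distributive lattice with a unary $\sim$ satisfying $\sim\sim x=x$ and $\sim(x\vee y)=\sim x\wedge\sim y$; a Kleene algebra is a De Morgan algebra with $x\wedge\sim x\leq y\vee\sim y$. A Nelson algebra is $\mathbf{T}=\langle T,\vee,\wedge,\to,\sim,0,1\rangle$ with Kleene reduct satisfying $x\to x=1$, $x\to(y\to z)=(x\wedge y)\to z$, $x\wedge(x\to y)=x\wedge(\sim x\vee y)$; prelinear if $(x\to y)\vee(y\to x)=1$; centered if there is a (unique) $c$ with $\sim c=c$. A monadic Nelson algebra is $(\mathbf{T},\exists)$ with $\mathbf{T}$ a Nelson algebra and, with $\forall x:=\sim\exists(\sim x)$: $\exists 0=0$; $x\leq\exists x$; $\exists(x\wedge\exists y)=\exists x\wedge\exists y$; $\exists(x\vee y)=\exists x\vee\exists y$; $\forall\exists x=\exists x$; $\forall(x\to y)\leq\exists x\to\exists y$; $\forall(x\to y)\leq\forall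 x\to\forall y$. A monadic $N_c$-algebra is a monadic Nelson algebra with $\mathbf{T}$ prelinear and centered with center $c$, and $c\in\exists(T)$; its homomorphisms are algebra homomorphisms preserving $\vee,\wedge,\to,\sim,0,1,\exists$. A Heyting algebra is $\langle A,\vee,\wedge,\Rightarrow,0,1\rangle$ with bounded lattice reduct satisfying $x\wedge(x\Rightarrow y)=x\wedge y$, $x\wedge(y\Rightarrow z)=x\wedge((x\wedge y)\Rightarrow(x\wedge z))$, $(x\wedge y)\Rightarrow x=1$. A monadic Heyting algebra is $(\mathbf{A},\forall,\exists)$ with unary operations satisfying $\forall x\leq x$, $x\leq\exists x$, $\forall(x\wedge y)=\forall x\wedge\forall y$, $\exists(x\vee y)=\exists x\vee\exists y$, $\forall 1=1$, $\exists 0=0$, $\forall\exists x=\exists x$, $\exists\forall x=\forall x$, $\forall(x\Rightarrow y)\leq\exists x\Rightarrow\exists y$. A monadic Gödel algebra is a monadic Heyting algebra satisfying $(x\Rightarrow y)\vee(y\Rightarrow x)=1$ and $\forall(\exists x\vee y)=\exists x\vee\forall y$; its homomorphisms preserve $\vee,\wedge,\Rightarrow,0,1,\forall,\exists$. (In $C(\mathbf{U})$ the bottom element is $c$ and $\Rightarrow$ is the restriction of $\to$.) -}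

module Defs where

open import Data.Product using (Σ; _×_; _,_; proj₁; proj₂; ∃-syntax)
open import Relation.Binary.PropositionalEquality using (_≡_)
open import Relation.Binary.Structures using (IsEquivalence)

record MonadicNc : Set₁ where
  infixr 6 _∨_
  infixr 7 _∧_
  infixr 5 _⇨_
  field
    Carrier : Set
    _∨_ _∧_ _⇨_ : Carrier → Carrier → Carrier
    ∼ : Carrier → Carrier
    𝟘 𝟙 : Carrier
    ∃' : Carrier → Carrier

  _≤_ : Carrier → Carrier → Set
  x ≤ y = x ∧ y ≡ x

  ∀' : Carrier → Carrier
  ∀' x = ∼ (∃' (∼ x))

  field
    ∨-assoc : ∀ x y z → (x ∨ y) ∨ z ≡ x ∨ (y ∨ z)
    ∧-assoc : ∀ x y z → (x ∧ y) ∧ z ≡ x ∧ (y ∧ z)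
    ∨-comm : ∀ x y → x ∨ y ≡ y ∨ x
    ∧-comm : ∀ x y → x ∧ y ≡ y ∧ x
    ∨-absorbs-∧ : ∀ x y → x ∨ (x ∧ y) ≡ x
    ∧-absorbs-∨ : ∀ x y → x ∧ (x ∨ y) ≡ x
    ∧-distrib-∨ : ∀ x y z → x ∧ (y ∨ z) ≡ (x ∧ y) ∨ (x ∧ z)
    𝟘-identity : ∀ x → x ∨ 𝟘 ≡ x
    𝟙-identity : ∀ x → x ∧ 𝟙 ≡ x
    ∼-invol : ∀ x → ∼ (∼ x) ≡ x
    ∼-∨ : ∀ x y → ∼ (x ∨ y) ≡ ∼ x ∧ ∼ y
    kleene : ∀ x y → (x ∧ ∼ x) ≤ (y ∨ ∼ y)
    ⇨-refl : ∀ x → x ⇨ x ≡ 𝟙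
    ⇨-curry : ∀ x y z → x ⇨ (y ⇨ z) ≡ (x ∧ y) ⇨ z
    ⇨-mp : ∀ x y → x ∧ (x ⇨ y) ≡ x ∧ (∼ x ∨ y)
    prelinear : ∀ x y → (x ⇨ y) ∨ (y ⇨ x) ≡ 𝟙
    c : Carrier
    ∼c : ∼ c ≡ c
    ∃-𝟘 : ∃' 𝟘 ≡ 𝟘
    ∃-incr : ∀ x → x ≤ ∃' x
    ∃-∧ : ∀ x y → ∃' (x ∧ ∃' y) ≡ ∃' x ∧ ∃' y
    ∃-∨ : ∀ x y → ∃' (x ∨ y) ≡ ∃' x ∨ ∃' y
    ∀∃ : ∀ x → ∀' (∃' x) ≡ ∃' x
    ∀⇨-∃ : ∀ x y → ∀' (x ⇨ y) ≤ (∃' x ⇨ ∃' y)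
    ∀⇨-∀ : ∀ x y → ∀' (x ⇨ y) ≤ (∀' x ⇨ ∀' y)
    c∈∃T : ∃[ t ] ∃' t ≡ c

record IsNcHom (T S : MonadicNc) (f : MonadicNc.Carrier T → MonadicNc.Carrier S) : Set where
  private
    module T = MonadicNc T
    module S = MonadicNc S
  field
    pres-∨ : ∀ x y → f (x T.∨ y) ≡ f x S.∨ f y
    pres-∧ : ∀ x y → f (x T.∧ y) ≡ f x S.∧ f y
    pres-⇨ : ∀ x y → f (x T.⇨ y) ≡ f x S.⇨ f y
    pres-∼ : ∀ x → f (T.∼ x) ≡ S.∼ (f x)
    pres-𝟘 : f T.𝟘 ≡ S.𝟘
    pres-𝟙 : f T.𝟙 ≡ S.𝟙
    pres-∃ : ∀ x → f (T.∃' x) ≡ S.∃' (f x)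

record IsMonadicGödel {A : Set} (_≈_ : A → A → Set)
         (_⊔_ _⊓_ _⇒_ : A → A → A) (⊥' ⊤' : A) (∀' ∃' : A → A) : Set where
  field
    isEquivalence : IsEquivalence _≈_
    ⊔-cong : ∀ {x x' y y'} → x ≈ x' → y ≈ y' → (x ⊔ y) ≈ (x' ⊔ y')
    ⊓-cong : ∀ {x x' y y'} → x ≈ x' → y ≈ y' → (x ⊓ y) ≈ (x' ⊓ y')
    ⇒-cong : ∀ {x x' y y'} → x ≈ x' → y ≈ y' → (x ⇒ y) ≈ (x' ⇒ y')
    ∀-cong : ∀ {x x'} → x ≈ x' → ∀' x ≈ ∀' x'
    ∃-cong : ∀ {x x'} → x ≈ x' → ∃' x ≈ ∃' x'
    ⊔-assoc : ∀ x y z → ((x ⊔ y) ⊔ z) ≈ (x ⊔ (y ⊔ z))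
    ⊓-assoc : ∀ x y z → ((x ⊓ y) ⊓ z) ≈ (x ⊓ (y ⊓ z))
    ⊔-comm : ∀ x y → (x ⊔ y) ≈ (y ⊔ x)
    ⊓-comm : ∀ x y → (x ⊓ y) ≈ (y ⊓ x)
    ⊔-absorbs-⊓ : ∀ x y → (x ⊔ (x ⊓ y)) ≈ x
    ⊓-absorbs-⊔ : ∀ x y → (x ⊓ (x ⊔ y)) ≈ x
    ⊥-identity : ∀ x → (x ⊔ ⊥') ≈ x
    ⊤-identity : ∀ x → (x ⊓ ⊤') ≈ x
    ⇒-mp : ∀ x y → (x ⊓ (x ⇒ y)) ≈ (x ⊓ y)
    ⇒-rel : ∀ x y z → (x ⊓ (y ⇒ z)) ≈ (x ⊓ ((x ⊓ y) ⇒ (x ⊓ z)))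
    ⇒-top : ∀ x y → ((x ⊓ y) ⇒ x) ≈ ⊤'
    -- monadic (x ≤ y  means  x ⊓ y ≈ x)
    ∀-decr : ∀ x → (∀' x ⊓ x) ≈ ∀' x
    ∃-incr : ∀ x → (x ⊓ ∃' x) ≈ x
    ∀-⊓ : ∀ x y → ∀' (x ⊓ y) ≈ (∀' x ⊓ ∀' y)
    ∃-⊔ : ∀ x y → ∃' (x ⊔ y) ≈ (∃' x ⊔ ∃' y)
    ∀-⊤ : ∀' ⊤' ≈ ⊤'
    ∃-⊥ : ∃' ⊥' ≈ ⊥'
    ∀∃ : ∀ x → ∀' (∃' x) ≈ ∃' x
    ∃∀ : ∀ x → ∃' (∀' x) ≈ ∀' x
    ∀⇒ : ∀ x y → (∀' (x ⇒ y) ⊓ (∃' x ⇒ ∃' y)) ≈ ∀' (x ⇒ y)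
    prelinear : ∀ x y → ((x ⇒ y) ⊔ (y ⇒ x)) ≈ ⊤'
    ∀-∃⊔ : ∀ x y → ∀' (∃' x ⊔ y) ≈ (∃' x ⊔ ∀' y)

record IsMGHom {A B : Set}
         (_≈A_ : A → A → Set) (_⊔A_ _⊓A_ _⇒A_ : A → A → A) (⊥A ⊤A : A) (∀A ∃A : A → A)
         (_≈B_ : B → B → Set) (_⊔B_ _⊓B_ _⇒B_ : B → B → B) (⊥B ⊤B : B) (∀B ∃B : B → B)
         (f : A → B) : Set where
  field
    cong : ∀ {x y} → x ≈A y → f x ≈B f y
    pres-⊔ : ∀ x y → f (x ⊔A y) ≈B (f x ⊔B f y)
    pres-⊓ : ∀ x y → f (x ⊓A y) ≈B (f x ⊓B f y)
    pres-⇒ : ∀ x y → f (x ⇒A y) ≈B (f x ⇒B f y)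
    pres-⊥ : f ⊥A ≈B ⊥B
    pres-⊤ : f ⊤A ≈B ⊤B
    pres-∀ : ∀ x → f (∀A x) ≈B ∀B (f x)
    pres-∃ : ∀ x → f (∃A x) ≈B ∃B (f x)

module _ (U : MonadicNc) where
  open MonadicNc U

  CT : Set
  CT = Σ Carrier (λ x → c ≤ x)

  _≈C_ : CT → CT → Set
  x ≈C y = proj₁ x ≡ proj₁ y

  record Closed : Set where
    field
      ∨-closed : ∀ x y → c ≤ x → c ≤ y → c ≤ (x ∨ y)
      ∧-closed : ∀ x y → c ≤ x → c ≤ y → c ≤ (x ∧ y)
      ⇨-closed : ∀ x y → c ≤ x → c ≤ y → c ≤ (x ⇨ y)
      c-closed : c ≤ c
      𝟙-closed : c ≤ 𝟙
      ∃-closed : ∀ x → c ≤ x → c ≤ ∃' x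
      ∀-closed : ∀ x → c ≤ x → c ≤ ∀' x

  module CU (cl : Closed) where
    open Closed cl
    _∨C_ _∧C_ _⇨C_ : CT → CT → CT
    (x , p) ∨C (y , q) = x ∨ y , ∨-closed x y p q
    (x , p) ∧C (y , q) = x ∧ y , ∧-closed x y p q
    (x , p) ⇨C (y , q) = x ⇨ y , ⇨-closed x y p q
    cC 𝟙C : CT
    cC = c , c-closed
    𝟙C = 𝟙 , 𝟙-closed
    ∃C ∀C : CT → CT
    ∃C (x , p) = ∃' x , ∃-closed x p
    ∀C (x , p) = ∀' x , ∀-closed x p

IsMonadicGödelC : (U : MonadicNc) → Closed U → Set
IsMonadicGödelC U cl =
  IsMonadicGödel (_≈C_ U) _∨C_ _∧C_ _⇨C_ cC 𝟙C ∀C ∃C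
  where open CU U cl

IsMGHomC : (U V : MonadicNc) → Closed U → Closed V → (CT U → CT V) → Set
IsMGHomC U V clU clV g =
  IsMGHom (_≈C_ U) U._∨C_ U._∧C_ U._⇨C_ U.cC U.𝟙C U.∀C U.∃C
          (_≈C_ V) V._∨C_ V._∧C_ V._⇨C_ V.cC V.𝟙C V.∀C V.∃C g
  where
  module U = CU U clU
  module V = CU V clV

Cf : (U V : MonadicNc) (f : MonadicNc.Carrier U → MonadicNc.Carrier V)
     → (∀ x → MonadicNc._≤_ U (MonadicNc.c U) x → MonadicNc._≤_ V (MonadicNc.c V) (f x))
     → CT U → CT V
Cf U V f m (x , p) = f x , m x p

-- The Kleene inequality x ∧ ∼x ≤ y ∨ ∼y, read with y = c, says x ∧ ∼x ≤ c. Hence above the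
-- center the Nelson axiom x ∧ (x ⇨ y) = x ∧ (∼x ∨ y) collapses to modus ponens
-- x ∧ (x ⇨ y) ≤ y, and together with currying this makes ⇨ the relative pseudocomplement
-- on C(T): the interval [c, 1] is a Heyting algebra with bottom c, and prelinearity makes it
-- Gödel. The quantifiers preserve C(T) because ∃c = c (c lies in ∃(T)) and ∀c = ∼∃∼c = c.
-- A homomorphism f maps c to c, since f c is again a fixed point of ∼ and the center is
-- unique, so it maps C(T) into C(S).
module Submission where

open import Level using (0ℓ)
open import Data.Product using (Σ; _×_; _,_; proj₁; proj₂)
open import Function using (_on_)
open import Relation.Binary.PropositionalEquality
  using (_≡_; refl; sym; trans; cong; cong₂; subst; subst₂; isEquivalence; module ≡-Reasoning)
import Algebra.Lattice.Bundles as Alg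
import Algebra.Lattice.Properties.Lattice as AlgLatticeProperties
open import Relation.Binary.Lattice using (IsLattice; Lattice; HeytingAlgebra)
import Relation.Binary.Lattice.Properties.HeytingAlgebra as HeytingAlgebraProperties
import Relation.Binary.Lattice.Properties.JoinSemilattice as JoinSemilatticeProperties
import Relation.Binary.Lattice.Properties.MeetSemilattice as MeetSemilatticeProperties
import Relation.Binary.Reasoning.PartialOrder as PartialOrderReasoning
import Relation.Binary.Construct.On as On

open import Defs

module HeytingAlgebraIdentities {c ℓ₁ ℓ₂} (H : HeytingAlgebra c ℓ₁ ℓ₂) where
  open HeytingAlgebra H renaming (refl to ≤-refl; trans to ≤-trans)
  open HeytingAlgebraProperties H using (⇨-eval; ⇨-app)
  open MeetSemilatticeProperties meetSemilattice using (∧-comm; ∧-monotonic)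
  open PartialOrderReasoning poset

  x∧[x⇨y]≈x∧y : ∀ x y → x ∧ (x ⇨ y) ≈ x ∧ y
  x∧[x⇨y]≈x∧y x y = begin-equality
    x ∧ (x ⇨ y) ≈⟨ ∧-comm x (x ⇨ y) ⟩
    (x ⇨ y) ∧ x ≈⟨ ⇨-app ⟩
    y ∧ x       ≈⟨ ∧-comm y x ⟩
    x ∧ y       ∎

  ∧-⇨-relativise : ∀ x y z → x ∧ (y ⇨ z) ≈ x ∧ (x ∧ y ⇨ x ∧ z)
  ∧-⇨-relativise x y z = antisym
    (∧-greatest (x∧y≤x _ _) (transpose-⇨ (∧-greatest
      (≤-trans (x∧y≤x _ _) (x∧y≤x _ _))
      (≤-trans (∧-monotonic (x∧y≤y _ _) (x∧y≤y _ _)) ⇨-eval))))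
    (∧-greatest (x∧y≤x _ _) (transpose-⇨ (begin
      (x ∧ w) ∧ y ≤⟨ ∧-greatest (≤-trans (x∧y≤x _ _) (x∧y≤y _ _))
                                (∧-monotonic (x∧y≤x _ _) ≤-refl) ⟩
      w ∧ (x ∧ y) ≤⟨ ⇨-eval ⟩
      x ∧ z       ≤⟨ x∧y≤y _ _ ⟩
      z           ∎)))
    where
    w : Carrier
    w = x ∧ y ⇨ x ∧ z

module NcProperties (U : MonadicNc) where
  open MonadicNc U
  open ≡-Reasoning

  ∨-∧-lattice : Alg.Lattice 0ℓ 0ℓ
  ∨-∧-lattice = record
    { _≈_       = _≡_
    ; _∨_       = _∨_
    ; _∧_       = _∧_
    ; isLattice = record
      { isEquivalence = isEquivalence
      ; ∨-comm        = ∨-comm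
      ; ∨-assoc       = ∨-assoc
      ; ∨-cong        = cong₂ _∨_
      ; ∧-comm        = ∧-comm
      ; ∧-assoc       = ∧-assoc
      ; ∧-cong        = cong₂ _∧_
      ; absorptive    = ∨-absorbs-∧ , ∧-absorbs-∨
      }
    }

  open AlgLatticeProperties ∨-∧-lattice using (∧-idem; ∨-idem; ∨-∧-orderTheoreticLattice)
  private module ≼ = Lattice ∨-∧-orderTheoreticLattice

  -- The library orders a lattice by x ≡ x ∧ y; MonadicNc uses the mirror image x ∧ y ≡ x.
  ≤-isLattice : IsLattice _≡_ _≤_ _∨_ _∧_
  ≤-isLattice = record
    { isPartialOrder = record
      { isPreorder = record
        { isEquivalence = isEquivalence
        ; reflexive     = λ { refl → ∧-idem _ }
        ; trans         = λ p q → sym (≼.trans (sym p) (sym q))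
        }
      ; antisym = λ p q → ≼.antisym (sym p) (sym q)
      }
    ; supremum = λ x y →
        sym (≼.x≤x∨y x y) , sym (≼.y≤x∨y x y) , λ _ p q → sym (≼.∨-least (sym p) (sym q))
    ; infimum = λ x y →
        sym (≼.x∧y≤x x y) , sym (≼.x∧y≤y x y) , λ _ p q → sym (≼.∧-greatest (sym p) (sym q))
    }

  ≤-lattice : Lattice 0ℓ 0ℓ 0ℓ
  ≤-lattice = record { isLattice = ≤-isLattice }

  open Lattice ≤-lattice public
    using (isPartialOrder; x∧y≤x; x∧y≤y; ∧-greatest; x≤x∨y; y≤x∨y; ∨-least)
    renaming (refl to ≤-refl; trans to ≤-trans; antisym to ≤-antisym)
  open JoinSemilatticeProperties (Lattice.joinSemilattice ≤-lattice) using (x≤y⇒x∨y≈y)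

  x≤𝟙 : ∀ x → x ≤ 𝟙
  x≤𝟙 = 𝟙-identity

  𝟘≤x : ∀ x → 𝟘 ≤ x
  𝟘≤x x = subst (𝟘 ≤_) (𝟘-identity x) (y≤x∨y x 𝟘)

  ∼-antitone : ∀ {x y} → x ≤ y → ∼ y ≤ ∼ x
  ∼-antitone {x} {y} x≤y = begin
    ∼ y ∧ ∼ x ≡⟨ ∧-comm (∼ y) (∼ x) ⟩
    ∼ x ∧ ∼ y ≡⟨ ∼-∨ x y ⟨
    ∼ (x ∨ y) ≡⟨ cong ∼ (x≤y⇒x∨y≈y x≤y) ⟩
    ∼ y       ∎

  ∼-∧ : ∀ x y → ∼ (x ∧ y) ≡ ∼ x ∨ ∼ y
  ∼-∧ x y = begin
    ∼ (x ∧ y)             ≡⟨ cong₂ (λ a b → ∼ (a ∧ b)) (∼-invol x) (∼-invol y) ⟨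
    ∼ (∼ (∼ x) ∧ ∼ (∼ y)) ≡⟨ cong ∼ (∼-∨ (∼ x) (∼ y)) ⟨
    ∼ (∼ (∼ x ∨ ∼ y))     ≡⟨ ∼-invol _ ⟩
    ∼ x ∨ ∼ y             ∎

  ∼𝟙≡𝟘 : ∼ 𝟙 ≡ 𝟘
  ∼𝟙≡𝟘 = ≤-antisym (subst (∼ 𝟙 ≤_) (∼-invol 𝟘) (∼-antitone (x≤𝟙 (∼ 𝟘)))) (𝟘≤x (∼ 𝟙))

  ∼𝟘≡𝟙 : ∼ 𝟘 ≡ 𝟙
  ∼𝟘≡𝟙 = trans (cong ∼ (sym ∼𝟙≡𝟘)) (∼-invol 𝟙)

  x∧∼x≤c : ∀ x → (x ∧ ∼ x) ≤ c
  x∧∼x≤c x = subst ((x ∧ ∼ x) ≤_) (trans (cong (c ∨_) ∼c) (∨-idem c)) (kleene x c)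

  center-unique : ∀ {x} → ∼ x ≡ x → x ≡ c
  center-unique {x} ∼x≡x = ≤-antisym
    (subst (_≤ c) (trans (cong (x ∧_) ∼x≡x) (∧-idem x)) (x∧∼x≤c x))
    (subst₂ _≤_ (trans (cong (c ∧_) ∼c) (∧-idem c)) (trans (cong (x ∨_) ∼x≡x) (∨-idem x))
      (kleene c x))

  x⇨𝟙≡𝟙 : ∀ x → x ⇨ 𝟙 ≡ 𝟙
  x⇨𝟙≡𝟙 x = begin
    x ⇨ 𝟙       ≡⟨ cong (x ⇨_) (⇨-refl x) ⟨
    x ⇨ (x ⇨ x) ≡⟨ ⇨-curry x x x ⟩
    x ∧ x ⇨ x   ≡⟨ cong (_⇨ x) (∧-idem x) ⟩
    x ⇨ x       ≡⟨ ⇨-refl x ⟩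
    𝟙           ∎

  x≤y⇒x⇨y≡𝟙 : ∀ {x y} → x ≤ y → x ⇨ y ≡ 𝟙
  x≤y⇒x⇨y≡𝟙 {x} {y} x≤y = begin
    x ⇨ y       ≡⟨ cong (_⇨ y) x≤y ⟨
    x ∧ y ⇨ y   ≡⟨ ⇨-curry x y y ⟨
    x ⇨ (y ⇨ y) ≡⟨ cong (x ⇨_) (⇨-refl y) ⟩
    x ⇨ 𝟙       ≡⟨ x⇨𝟙≡𝟙 x ⟩
    𝟙           ∎

  x∧[x⇨y]≡x∧∼x∨x∧y : ∀ x y → x ∧ (x ⇨ y) ≡ x ∧ ∼ x ∨ x ∧ y
  x∧[x⇨y]≡x∧∼x∨x∧y x y = trans (⇨-mp x y) (∧-distrib-∨ x (∼ x) y)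

  x∧[x⇨y]≤y : ∀ {x y} → c ≤ y → (x ∧ (x ⇨ y)) ≤ y
  x∧[x⇨y]≤y {x} {y} c≤y = subst (_≤ y) (sym (x∧[x⇨y]≡x∧∼x∨x∧y x y))
    (∨-least (≤-trans (x∧∼x≤c x) c≤y) (x∧y≤y x y))

  c≤x⇨y : ∀ {x y} → c ≤ x → c ≤ y → c ≤ (x ⇨ y)
  c≤x⇨y {x} {y} c≤x c≤y = ≤-trans (∧-greatest c≤x c≤y) (≤-trans x∧y≤x∧[x⇨y] (x∧y≤y x (x ⇨ y)))
    where
    x∧y≤x∧[x⇨y] : (x ∧ y) ≤ (x ∧ (x ⇨ y))
    x∧y≤x∧[x⇨y] = subst ((x ∧ y) ≤_) (sym (x∧[x⇨y]≡x∧∼x∨x∧y x y)) (y≤x∨y (x ∧ ∼ x) (x ∧ y))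

  x⇨y≡𝟙⇒x≤y : ∀ {x y} → c ≤ y → x ⇨ y ≡ 𝟙 → x ≤ y
  x⇨y≡𝟙⇒x≤y {x} c≤y x⇨y≡𝟙 = subst (_≤ _) (trans (cong (x ∧_) x⇨y≡𝟙) (𝟙-identity x)) (x∧[x⇨y]≤y c≤y)

  transpose-⇨ : ∀ {w x y} → c ≤ x → c ≤ y → (w ∧ x) ≤ y → w ≤ (x ⇨ y)
  transpose-⇨ {w} {x} {y} c≤x c≤y w∧x≤y =
    x⇨y≡𝟙⇒x≤y (c≤x⇨y c≤x c≤y) (trans (⇨-curry w x y) (x≤y⇒x⇨y≡𝟙 w∧x≤y))

  transpose-∧ : ∀ {w x y} → c ≤ y → w ≤ (x ⇨ y) → (w ∧ x) ≤ y
  transpose-∧ {w} {x} c≤y w≤x⇨y =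
    ≤-trans (∧-greatest (x∧y≤y w x) (≤-trans (x∧y≤x w x) w≤x⇨y)) (x∧[x⇨y]≤y c≤y)

  ∃-monotone : ∀ {x y} → x ≤ y → ∃' x ≤ ∃' y
  ∃-monotone {x} {y} x≤y = begin
    ∃' x ∧ ∃' y     ≡⟨ ∃-∧ x y ⟨
    ∃' (x ∧ ∃' y)   ≡⟨ cong ∃' (≤-trans x≤y (∃-incr y)) ⟩
    ∃' x            ∎

  ∃-idem : ∀ x → ∃' (∃' x) ≡ ∃' x
  ∃-idem x = ≤-antisym
    (trans (sym (∃-∧ (∃' x) x)) (cong ∃' (∧-idem (∃' x))))
    (∃-incr (∃' x))

  ∃c≡c : ∃' c ≡ c
  ∃c≡c with c∈∃T
  ... | t , ∃t≡c = begin
    ∃' c        ≡⟨ cong ∃' ∃t≡c ⟨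
    ∃' (∃' t)   ≡⟨ ∃-idem t ⟩
    ∃' t        ≡⟨ ∃t≡c ⟩
    c           ∎

  ∃∼∃≡∼∃ : ∀ x → ∃' (∼ (∃' x)) ≡ ∼ (∃' x)
  ∃∼∃≡∼∃ x = trans (sym (∼-invol _)) (cong ∼ (∀∃ x))

  ∀-decreasing : ∀ x → ∀' x ≤ x
  ∀-decreasing x = subst (∀' x ≤_) (∼-invol x) (∼-antitone (∃-incr (∼ x)))

  ∀-monotone : ∀ {x y} → x ≤ y → ∀' x ≤ ∀' y
  ∀-monotone x≤y = ∼-antitone (∃-monotone (∼-antitone x≤y))

  ∀c≡c : ∀' c ≡ c
  ∀c≡c = trans (cong (λ t → ∼ (∃' t)) ∼c) (trans (cong ∼ ∃c≡c) ∼c)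

  ∀-∧ : ∀ x y → ∀' (x ∧ y) ≡ ∀' x ∧ ∀' y
  ∀-∧ x y = begin
    ∼ (∃' (∼ (x ∧ y)))          ≡⟨ cong (λ t → ∼ (∃' t)) (∼-∧ x y) ⟩
    ∼ (∃' (∼ x ∨ ∼ y))          ≡⟨ cong ∼ (∃-∨ (∼ x) (∼ y)) ⟩
    ∼ (∃' (∼ x) ∨ ∃' (∼ y))     ≡⟨ ∼-∨ _ _ ⟩
    ∀' x ∧ ∀' y                 ∎

  ∀𝟙≡𝟙 : ∀' 𝟙 ≡ 𝟙
  ∀𝟙≡𝟙 = trans (cong (λ t → ∼ (∃' t)) ∼𝟙≡𝟘) (trans (cong ∼ ∃-𝟘) ∼𝟘≡𝟙)

  ∃∀≡∀ : ∀ x → ∃' (∀' x) ≡ ∀' x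
  ∃∀≡∀ x = ∃∼∃≡∼∃ (∼ x)

  ∀-∃∨ : ∀ x y → ∀' (∃' x ∨ y) ≡ ∃' x ∨ ∀' y
  ∀-∃∨ x y = begin
    ∼ (∃' (∼ (∃' x ∨ y)))             ≡⟨ cong (λ t → ∼ (∃' t)) (∼-∨ (∃' x) y) ⟩
    ∼ (∃' (∼ (∃' x) ∧ ∼ y))           ≡⟨ cong (λ t → ∼ (∃' t)) (∧-comm _ _) ⟩
    ∼ (∃' (∼ y ∧ ∼ (∃' x)))           ≡⟨ cong (λ t → ∼ (∃' (∼ y ∧ t))) (∃∼∃≡∼∃ x) ⟨
    ∼ (∃' (∼ y ∧ ∃' (∼ (∃' x))))      ≡⟨ cong ∼ (∃-∧ (∼ y) (∼ (∃' x))) ⟩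
    ∼ (∃' (∼ y) ∧ ∃' (∼ (∃' x)))      ≡⟨ cong (λ t → ∼ (∃' (∼ y) ∧ t)) (∃∼∃≡∼∃ x) ⟩
    ∼ (∃' (∼ y) ∧ ∼ (∃' x))           ≡⟨ ∼-∧ _ _ ⟩
    ∀' y ∨ ∼ (∼ (∃' x))               ≡⟨ cong (∀' y ∨_) (∼-invol _) ⟩
    ∀' y ∨ ∃' x                       ≡⟨ ∨-comm _ _ ⟩
    ∃' x ∨ ∀' y                       ∎

  closed : Closed U
  closed = record
    { ∨-closed = λ x y c≤x _ → ≤-trans c≤x (x≤x∨y x y)
    ; ∧-closed = λ _ _ → ∧-greatest
    ; ⇨-closed = λ _ _ → c≤x⇨y
    ; c-closed = ≤-refl
    ; 𝟙-closed = x≤𝟙 c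
    ; ∃-closed = λ x c≤x → ≤-trans c≤x (∃-incr x)
    ; ∀-closed = λ x c≤x → subst (_≤ ∀' x) ∀c≡c (∀-monotone c≤x)
    }

  module _ (cl : Closed U) where
    open CU U cl

    C-heytingAlgebra : HeytingAlgebra 0ℓ 0ℓ 0ℓ
    C-heytingAlgebra = record
      { _≈_ = _≈C_ U
      ; _≤_ = _≤_ on proj₁
      ; _∨_ = _∨C_
      ; _∧_ = _∧C_
      ; _⇨_ = _⇨C_
      ; ⊤   = 𝟙C
      ; ⊥   = cC
      ; isHeytingAlgebra = record
        { isBoundedLattice = record
          { isLattice = record
            { isPartialOrder = On.isPartialOrder proj₁ isPartialOrder
            ; supremum       = λ x y → x≤x∨y _ _ , y≤x∨y _ _ , λ _ → ∨-least
            ; infimum        = λ x y → x∧y≤x _ _ , x∧y≤y _ _ , λ _ → ∧-greatest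
            }
          ; maximum = λ x → x≤𝟙 (proj₁ x)
          ; minimum = proj₂
          }
        ; exponential = λ _ x y →
            transpose-⇨ (proj₂ x) (proj₂ y) , transpose-∧ (proj₂ y)
        }
      }

    open HeytingAlgebraIdentities C-heytingAlgebra

    isMonadicGödel : IsMonadicGödelC U cl
    isMonadicGödel = record
      { isEquivalence = record { refl = refl ; sym = sym ; trans = trans }
      ; ⊔-cong        = cong₂ _∨_
      ; ⊓-cong        = cong₂ _∧_
      ; ⇒-cong        = cong₂ _⇨_
      ; ∀-cong        = cong ∀'
      ; ∃-cong        = cong ∃'
      ; ⊔-assoc       = λ x y z → ∨-assoc (proj₁ x) (proj₁ y) (proj₁ z)
      ; ⊓-assoc       = λ x y z → ∧-assoc (proj₁ x) (proj₁ y) (proj₁ z)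
      ; ⊔-comm        = λ x y → ∨-comm (proj₁ x) (proj₁ y)
      ; ⊓-comm        = λ x y → ∧-comm (proj₁ x) (proj₁ y)
      ; ⊔-absorbs-⊓   = λ x y → ∨-absorbs-∧ (proj₁ x) (proj₁ y)
      ; ⊓-absorbs-⊔   = λ x y → ∧-absorbs-∨ (proj₁ x) (proj₁ y)
      ; ⊥-identity    = λ x → trans (∨-comm (proj₁ x) c) (x≤y⇒x∨y≈y (proj₂ x))
      ; ⊤-identity    = λ x → 𝟙-identity (proj₁ x)
      ; ⇒-mp          = x∧[x⇨y]≈x∧y
      ; ⇒-rel         = ∧-⇨-relativise
      ; ⇒-top         = λ x y → x≤y⇒x⇨y≡𝟙 (x∧y≤x (proj₁ x) (proj₁ y))
      ; ∀-decr        = λ x → ∀-decreasing (proj₁ x)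
      ; ∃-incr        = λ x → ∃-incr (proj₁ x)
      ; ∀-⊓           = λ x y → ∀-∧ (proj₁ x) (proj₁ y)
      ; ∃-⊔           = λ x y → ∃-∨ (proj₁ x) (proj₁ y)
      ; ∀-⊤           = ∀𝟙≡𝟙
      ; ∃-⊥           = ∃c≡c
      ; ∀∃            = λ x → ∀∃ (proj₁ x)
      ; ∃∀            = λ x → ∃∀≡∀ (proj₁ x)
      ; ∀⇒            = λ x y → ∀⇨-∃ (proj₁ x) (proj₁ y)
      ; prelinear     = λ x y → prelinear (proj₁ x) (proj₁ y)
      ; ∀-∃⊔          = λ x y → ∀-∃∨ (proj₁ x) (proj₁ y)
      }

module NcHomomorphism (U V : MonadicNc) (f : MonadicNc.Carrier U → MonadicNc.Carrier V)
                      (isNcHom : IsNcHom U V f) where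
  private
    module U = MonadicNc U
    module V = MonadicNc V
  open IsNcHom isNcHom

  f-c≡c : f U.c ≡ V.c
  f-c≡c = NcProperties.center-unique V (trans (sym (pres-∼ U.c)) (cong f U.∼c))

  f-monotone : ∀ {x y} → x U.≤ y → f x V.≤ f y
  f-monotone {x} {y} x≤y = trans (sym (pres-∧ x y)) (cong f x≤y)

  f-preserves-C : ∀ x → U.c U.≤ x → V.c V.≤ f x
  f-preserves-C _ c≤x = subst (V._≤ _) f-c≡c (f-monotone c≤x)

  f-∀ : ∀ x → f (U.∀' x) ≡ V.∀' (f x)
  f-∀ x = trans (pres-∼ _) (cong V.∼ (trans (pres-∃ _) (cong V.∃' (pres-∼ x))))

  C-isMGHom : (clU : Closed U) (clV : Closed V) → IsMGHomC U V clU clV (Cf U V f f-preserves-C)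
  C-isMGHom _ _ = record
    { cong   = cong f
    ; pres-⊔ = λ x y → pres-∨ (proj₁ x) (proj₁ y)
    ; pres-⊓ = λ x y → pres-∧ (proj₁ x) (proj₁ y)
    ; pres-⇒ = λ x y → pres-⇨ (proj₁ x) (proj₁ y)
    ; pres-⊥ = f-c≡c
    ; pres-⊤ = pres-𝟙
    ; pres-∀ = λ x → f-∀ (proj₁ x)
    ; pres-∃ = λ x → pres-∃ (proj₁ x)
    }

lemma7 :
    ((U : MonadicNc) → Closed U)
    × ((U : MonadicNc) (cl : Closed U) → IsMonadicGödelC U cl)
    × ((U V : MonadicNc) (clU : Closed U) (clV : Closed V)
        (f : MonadicNc.Carrier U → MonadicNc.Carrier V) → IsNcHom U V f
        → Σ (∀ x → MonadicNc._≤_ U (MonadicNc.c U) x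
                 → MonadicNc._≤_ V (MonadicNc.c V) (f x))
            (λ m → IsMGHomC U V clU clV (Cf U V f m)))
lemma7 =
    NcProperties.closed
  , NcProperties.isMonadicGödel
  , λ U V clU clV f isNcHom → let open NcHomomorphism U V f isNcHom in
      f-preserves-C , C-isMGHom clU clV
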